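{- Assume function extensionality for $\mathbf{0}$-valued functions. Then weak excluded middle holds if and only if there exist a function $f:\prod_{X:\mathcal{U}}X\to\mathbf{2}$ that is invariant under equivalence, types $X,Y:\mathcal{U}$ and isolated points $x:X$, $y:Y$ such that $f_X(x)\neq f_Y(y)$.
   Context: Work in intensional Martin-Löf type theory with $\Pi$-, $\Sigma$-, identity, finite types and natural numbers, and a universe $\mathcal{U}$ closed under these. $=$ is the identity type, $\neg A$ is $A\to\mathbf{0}$, $a\neq b$ is $\neg(a=b)$, $f_X$ abbreviates $f(X)$. Function extensionality for $\mathbf{0}$-valued functions: pointwise equal functions $A\to\mathbf{0}$ are equal. Weak excluded middle: for all $A:\mathcal{U}$, $\neg A+\neg\neg A$. An equivalence is a map with a left and a right inverse. $f:\prod_{X:\mathcal{U}}X\to\mathbf{2}$ is invariant under equivalence if $f_Y(e(x))=f_X(x)$ for all $X,Y:\mathcal{U}$, equivalences $e:X\to Y$ and $x:X$. A point $x:X$ is isolated if $\prod_{y:X}(x=y)+(x\neq y)$. -}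

module Defs where

open import Data.Bool using (Bool)
open import Data.Empty using (⊥)
open import Data.Product using (Σ; _×_; ∃)
open import Data.Sum using (_⊎_)
open import Relation.Nullary using (¬_)
open import Relation.Binary.PropositionalEquality using (_≡_; _≢_)

FunExt₀ : Set₁
FunExt₀ = {A : Set} (f g : A → ⊥) → ((x : A) → f x ≡ g x) → f ≡ g

WEM : Set₁
WEM = (A : Set) → ¬ A ⊎ ¬ ¬ A

IsEquiv : {X Y : Set} → (X → Y) → Set
IsEquiv {X} {Y} e =
  (Σ (Y → X) λ g → (x : X) → g (e x) ≡ x) ×
  (Σ (Y → X) λ h → (y : Y) → e (h y) ≡ y)

InvariantUnderEquiv : ((X : Set) → X → Bool) → Set₁
InvariantUnderEquiv f =
  (X Y : Set) (e : X → Y) → IsEquiv e → (x : X) → f Y (e x) ≡ f X x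

IsIsolated : {X : Set} → X → Set
IsIsolated {X} x = (y : X) → (x ≡ y) ⊎ (x ≢ y)

module Submission where

open import Defs
open import Data.Bool using (Bool; true; false)
open import Data.Bool.Properties using () renaming (_≟_ to _≟ᴮ_)
open import Data.Empty using (⊥-elim)
open import Data.Product using (Σ; _×_; _,_)
open import Data.Sum using (_⊎_; inj₁; inj₂; swap; map₂)
open import Data.Sum.Properties using (swap-involutive)
open import Data.Unit using (⊤; tt)
open import Relation.Binary.Definitions using (DecidableEquality)
open import Relation.Binary.PropositionalEquality
  using (_≡_; _≢_; refl; sym; trans; cong; cong₂; module ≡-Reasoning)
open import Relation.Nullary using (¬_; yes; no)
open import Relation.Nullary.Decidable using (toSum)

-- Weak excluded middle lets a function on types be defined by deciding the
-- proposition "x is the centre of contraction of X", which is invariant under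
-- equivalence and separates the isolated points tt : ⊤ and true : Bool.
-- Conversely, given f separating isolated x : X and y : Y, glue X and Y along
-- x and y, keeping the rest of X only under ¬¬A and the rest of Y only under
-- ¬A.  The glued type is equivalent to X (pointed at x) if ¬¬A and to Y
-- (pointed at y) if ¬A, so comparing its f-value with f X x decides between
-- ¬A and ¬¬A.

IsIsolated-decidable : {X : Set} → DecidableEquality X → (x : X) → IsIsolated x
IsIsolated-decidable _≟_ x y = toSum (x ≟ y)

¬-isProp : FunExt₀ → {A : Set} (u v : ¬ A) → u ≡ v
¬-isProp fe u v = fe u v (λ a → ⊥-elim (u a))

true≢false : true ≢ false
true≢false ()

IsCentre : {X : Set} → X → Set
IsCentre {X} x = (x′ : X) → x ≡ x′

IsCentre-transport : {X Y : Set} {e : X → Y} → IsEquiv e →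
                     {x : X} → IsCentre x → IsCentre (e x)
IsCentre-transport {e = e} (_ , (h , e∘h≡id)) centre y =
  trans (cong e (centre (h y))) (e∘h≡id y)

IsCentre-reflect : {X Y : Set} {e : X → Y} → IsEquiv e →
                   {x : X} → IsCentre (e x) → IsCentre x
IsCentre-reflect {e = e} ((g , g∘e≡id) , _) {x} centre x′ =
  trans (sym (g∘e≡id x)) (trans (cong g (centre (e x′))) (g∘e≡id x′))

module _ (wem : WEM) where

  decide : Set → Bool
  decide A with wem A
  ... | inj₁ _ = false
  ... | inj₂ _ = true

  decide-true : {A : Set} → A → decide A ≡ true
  decide-true {A} a with wem A
  ... | inj₁ ¬a = ⊥-elim (¬a a)
  ... | inj₂ _ = refl

  decide-false : {A : Set} → ¬ A → decide A ≡ false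
  decide-false {A} ¬a with wem A
  ... | inj₁ _ = refl
  ... | inj₂ ¬¬a = ⊥-elim (¬¬a ¬a)

  decide-cong : {A B : Set} → (A → B) → (B → A) → decide A ≡ decide B
  decide-cong {A} {B} to from with wem A | wem B
  ... | inj₁ _   | inj₁ _   = refl
  ... | inj₂ _   | inj₂ _   = refl
  ... | inj₁ ¬a  | inj₂ ¬¬b = ⊥-elim (¬¬b (λ b → ¬a (from b)))
  ... | inj₂ ¬¬a | inj₁ ¬b  = ⊥-elim (¬¬a (λ a → ¬b (to a)))

  isCentre? : (X : Set) → X → Bool
  isCentre? X x = decide (IsCentre x)

  isCentre?-invariant : InvariantUnderEquiv isCentre?
  isCentre?-invariant X Y e e-equiv x =
    decide-cong (IsCentre-reflect e-equiv) (IsCentre-transport e-equiv)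

  isCentre?-⊤ : isCentre? ⊤ tt ≡ true
  isCentre?-⊤ = decide-true λ { tt → refl }

  isCentre?-Bool : isCentre? Bool true ≡ false
  isCentre?-Bool = decide-false λ centre → true≢false (centre false)

_∖_ : (X : Set) → X → Set
X ∖ x = Σ X (x ≢_)

module _ (fe : FunExt₀) {B C S X : Set} {x : X} (x-isolated : IsIsolated x)
         (b : B) (B-isProp : (b₁ b₂ : B) → b₁ ≡ b₂) (¬c : ¬ C) where

  collapse : ⊤ ⊎ ((B × X ∖ x) ⊎ (C × S)) → X
  collapse (inj₁ tt)                   = x
  collapse (inj₂ (inj₁ (_ , x′ , _))) = x′
  collapse (inj₂ (inj₂ (c , _)))      = ⊥-elim (¬c c)

  expand : X → ⊤ ⊎ ((B × X ∖ x) ⊎ (C × S))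
  expand x′ with x-isolated x′
  ... | inj₁ _     = inj₁ tt
  ... | inj₂ x≢x′ = inj₂ (inj₁ (b , x′ , x≢x′))

  collapse∘expand : (x′ : X) → collapse (expand x′) ≡ x′
  collapse∘expand x′ with x-isolated x′
  ... | inj₁ x≡x′ = x≡x′
  ... | inj₂ _    = refl

  expand∘collapse : (t : ⊤ ⊎ ((B × X ∖ x) ⊎ (C × S))) → expand (collapse t) ≡ t
  expand∘collapse (inj₁ tt) with x-isolated x
  ... | inj₁ _   = refl
  ... | inj₂ x≢x = ⊥-elim (x≢x refl)
  expand∘collapse (inj₂ (inj₁ (b′ , x′ , x≢x′))) with x-isolated x′
  ... | inj₁ x≡x′  = ⊥-elim (x≢x′ x≡x′)
  ... | inj₂ x≢x′′ =
    cong (λ z → inj₂ (inj₁ z))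
         (cong₂ _,_ (B-isProp b b′) (cong (x′ ,_) (¬-isProp fe x≢x′′ x≢x′)))
  expand∘collapse (inj₂ (inj₂ (c , _))) = ⊥-elim (¬c c)

  collapse-isEquiv : IsEquiv collapse
  collapse-isEquiv = (expand , expand∘collapse) , (expand , collapse∘expand)

swap-inner : {P Q : Set} → ⊤ ⊎ (P ⊎ Q) → ⊤ ⊎ (Q ⊎ P)
swap-inner = map₂ swap

swap-inner-isEquiv : {P Q : Set} → IsEquiv (swap-inner {P} {Q})
swap-inner-isEquiv = (swap-inner , swap-inner-involutive) , (swap-inner , swap-inner-involutive)
  where
  swap-inner-involutive : ∀ {P Q} (t : ⊤ ⊎ (P ⊎ Q)) → swap-inner (swap-inner t) ≡ t
  swap-inner-involutive (inj₁ tt) = refl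
  swap-inner-involutive (inj₂ s)  = cong inj₂ (swap-involutive s)

Glue : (A X : Set) → X → (Y : Set) → Y → Set
Glue A X x Y y = ⊤ ⊎ ((¬ ¬ A × X ∖ x) ⊎ (¬ A × Y ∖ y))

module _ (fe : FunExt₀) {f : (X : Set) → X → Bool} (f-invariant : InvariantUnderEquiv f)
         (A : Set) {X Y : Set} {x : X} {y : Y} where

  f-Glue-¬¬ : IsIsolated x → ¬ ¬ A → f (Glue A X x Y y) (inj₁ tt) ≡ f X x
  f-Glue-¬¬ x-isolated ¬¬a =
    sym (f-invariant _ X _ (collapse-isEquiv fe x-isolated ¬¬a (¬-isProp fe) ¬¬a) (inj₁ tt))

  f-Glue-¬ : IsIsolated y → ¬ A → f (Glue A X x Y y) (inj₁ tt) ≡ f Y y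
  f-Glue-¬ y-isolated ¬a = begin
    f (Glue A X x Y y) (inj₁ tt) ≡⟨ sym (f-invariant _ _ swap-inner swap-inner-isEquiv (inj₁ tt)) ⟩
    f (⊤ ⊎ ((¬ A × Y ∖ y) ⊎ (¬ ¬ A × X ∖ x))) (inj₁ tt)
      ≡⟨ sym (f-invariant _ Y _ (collapse-isEquiv fe y-isolated ¬a (¬-isProp fe) (λ ¬¬a → ¬¬a ¬a)) (inj₁ tt)) ⟩
    f Y y ∎
    where open ≡-Reasoning

SeparatesIsolatedPoints : ((X : Set) → X → Bool) → Set₁
SeparatesIsolatedPoints f =
  Σ Set λ X → Σ Set λ Y → Σ X λ x → Σ Y λ y →
    IsIsolated x × IsIsolated y × (f X x ≢ f Y y)

wem⇒separating-invariant : WEM → Σ ((X : Set) → X → Bool) λ f →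
                           InvariantUnderEquiv f × SeparatesIsolatedPoints f
wem⇒separating-invariant wem =
  isCentre? wem , isCentre?-invariant wem ,
  ⊤ , Bool , tt , true ,
  (λ { tt → inj₁ refl }) , IsIsolated-decidable _≟ᴮ_ true ,
  λ same → true≢false (trans (sym (isCentre?-⊤ wem)) (trans same (isCentre?-Bool wem)))

separating-invariant⇒wem : FunExt₀ →
  Σ ((X : Set) → X → Bool) (λ f → InvariantUnderEquiv f × SeparatesIsolatedPoints f) → WEM
separating-invariant⇒wem fe (f , f-invariant , X , Y , x , y , x-isolated , y-isolated , fx≢fy) A
  with f (Glue A X x Y y) (inj₁ tt) ≟ᴮ f X x
... | yes same = inj₂ λ ¬a → fx≢fy (trans (sym same) (f-Glue-¬ fe f-invariant A y-isolated ¬a))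
... | no differ = inj₁ λ a → differ (f-Glue-¬¬ fe f-invariant A x-isolated (λ ¬a → ¬a a))

theorem2p8 : FunExt₀ →
    (WEM → Σ ((X : Set) → X → Bool) λ f → InvariantUnderEquiv f ×
      Σ Set λ X → Σ Set λ Y → Σ X λ x → Σ Y λ y →
        IsIsolated x × IsIsolated y × (f X x ≢ f Y y))
    × (Σ ((X : Set) → X → Bool) (λ f → InvariantUnderEquiv f ×
      Σ Set λ X → Σ Set λ Y → Σ X λ x → Σ Y λ y →
        IsIsolated x × IsIsolated y × (f X x ≢ f Y y)) → WEM)
theorem2p8 fe = wem⇒separating-invariant , separating-invariant⇒wem fe
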